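{- Let $n\ge1$ and $m\ge 0$, and let $G$ be a graph obtained from the complete bipartite graph $K_{3,n}$ by adding $m$ edges, each joining two distinct vertices of the part of size $3$ (parallel edges allowed). Then $\Gamma(G)\cong\Gamma(K_{3,n})\times\mathbb{Z}_2^m$.
   Context: Graphs are finite, multiple edges allowed, no loops; $E(v)$ is the set of edges incident to $v$. $\Gamma(G)$ is the group generated by $\{x_e:e\in E(G)\}$ with relations $x_e^2=1$ for all $e$, $[x_e,x_{e'}]=1$ whenever $e,e'\in E(v)$ for some vertex $v$, and $\prod_{e\in E(v)}x_e=1$ for each vertex $v$. -}

module Defs where

open import Level using (0ℓ)
open import Data.Nat using (ℕ; zero; suc; _+_; _*_)
open import Data.Fin using (Fin; _↑ˡ_; _↑ʳ_; splitAt; remQuot; _≟_)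
open import Data.Fin.Base using (Fin)
open import Data.List using (List; []; _∷_; foldr; filter)
open import Data.List.Base using (List)
open import Data.Fin.Base using ()
open import Data.List.Base using ()
open import Data.Product using (_×_; _,_; proj₁; proj₂)
open import Data.Sum using (_⊎_; inj₁; inj₂)
open import Data.Sum.Relation.Unary.All using ()
open import Relation.Binary.PropositionalEquality using (_≡_)
open import Relation.Binary using (Rel)
open import Relation.Nullary using (Dec; yes; no)
open import Relation.Nullary.Decidable using (_⊎-dec_)
open import Algebra.Bundles using (Group; CommutativeRing)
import Algebra.Construct.DirectProduct as DP
import Algebra.Construct.Terminal as Term
open import Data.Bool.Properties using (xor-∧-commutativeRing)
import Data.List as L

infixl 7 _·_
data Word (X : Set) : Set where
  gen : X → Word X
  e   : Word X
  _·_ : Word X → Word X → Word X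
  inv : Word X → Word X

module Presentation {X : Set} (R : Rel (Word X) 0ℓ) where

  infix 4 _~_
  data _~_ : Word X → Word X → Set where
    ~-refl  : ∀ {u} → u ~ u
    ~-sym   : ∀ {u v} → u ~ v → v ~ u
    ~-trans : ∀ {u v w} → u ~ v → v ~ w → u ~ w
    ·-cong  : ∀ {u u' v v'} → u ~ u' → v ~ v' → u · v ~ u' · v'
    inv-cong : ∀ {u v} → u ~ v → inv u ~ inv v
    assoc   : ∀ u v w → (u · v) · w ~ u · (v · w)
    idˡ     : ∀ u → e · u ~ u
    idʳ     : ∀ u → u · e ~ u
    invˡ    : ∀ u → inv u · u ~ e
    invʳ    : ∀ u → u · inv u ~ e
    rel     : ∀ {u v} → R u v → u ~ v

  group : Group 0ℓ 0ℓ
  group = record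
    { Carrier = Word X
    ; _≈_ = _~_
    ; _∙_ = _·_
    ; ε = e
    ; _⁻¹ = inv
    ; isGroup = record
      { isMonoid = record
        { isSemigroup = record
          { isMagma = record
            { isEquivalence = record { refl = ~-refl ; sym = ~-sym ; trans = ~-trans }
            ; ∙-cong = ·-cong }
          ; assoc = assoc }
        ; identity = idˡ , idʳ }
      ; inverse = invˡ , invʳ
      ; ⁻¹-cong = inv-cong }
    }

-- Finite multigraphs: vertices Fin V, edges Fin E, each edge with two
-- endpoints (looplessness is imposed where graphs are constructed).

record Graph : Set where
  field
    V   : ℕ
    E   : ℕ
    src : Fin E → Fin V
    tgt : Fin E → Fin V

module _ (G : Graph) where
  open Graph G

  Incident : Fin V → Fin E → Set
  Incident v ed = (src ed ≡ v) ⊎ (tgt ed ≡ v)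

  incident? : ∀ v ed → Dec (Incident v ed)
  incident? v ed = (src ed ≟ v) ⊎-dec (tgt ed ≟ v)

  edgesAt : Fin V → List (Fin E)
  edgesAt v = filter (incident? v) (L.allFin E)

  vertexProduct : Fin V → Word (Fin E)
  vertexProduct v = foldr (λ ed w → gen ed · w) e (edgesAt v)

  data ΓRel : Word (Fin E) → Word (Fin E) → Set where
    square  : ∀ ed → ΓRel (gen ed · gen ed) e
    commute : ∀ v ed ed' → Incident v ed → Incident v ed' →
              ΓRel (gen ed · gen ed') (gen ed' · gen ed)
    vertex  : ∀ v → ΓRel (vertexProduct v) e

  Γ : Group 0ℓ 0ℓ
  Γ = Presentation.group ΓRel

-- K_{3,n} with m extra edges inside the part of size 3.
-- Vertices: Fin (3 + n); the part of size 3 is  i ↑ˡ n  (i : Fin 3),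
-- the part of size n is  3 ↑ʳ j  (j : Fin n).
-- Edges: Fin (3 * n + m); the first 3n are the edges {i, j} of K_{3,n},
-- the last m are the added edges, the k-th joining the endpoints f k.

K3n+ : (n m : ℕ) → (Fin m → Fin 3 × Fin 3) → Graph
K3n+ n m f = record
  { V = 3 + n
  ; E = 3 * n + m
  ; src = λ ed → s (splitAt (3 * n) ed)
  ; tgt = λ ed → t (splitAt (3 * n) ed)
  }
  where
  s : Fin (3 * n) ⊎ Fin m → Fin (3 + n)
  s (inj₁ i) = proj₁ (remQuot {3} n i) ↑ˡ n
  s (inj₂ k) = proj₁ (f k) ↑ˡ n
  t : Fin (3 * n) ⊎ Fin m → Fin (3 + n)
  t (inj₁ i) = 3 ↑ʳ proj₂ (remQuot {3} n i)
  t (inj₂ k) = proj₂ (f k) ↑ˡ n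

K3n : ℕ → Graph
K3n n = K3n+ n 0 (λ ())

ℤ₂ : Group 0ℓ 0ℓ
ℤ₂ = CommutativeRing.+-group xor-∧-commutativeRing

ℤ₂^ : ℕ → Group 0ℓ 0ℓ
ℤ₂^ zero    = Term.group
ℤ₂^ (suc m) = DP.group ℤ₂ (ℤ₂^ m)

_×ᴳ_ : Group 0ℓ 0ℓ → Group 0ℓ 0ℓ → Group 0ℓ 0ℓ
G ×ᴳ H = DP.group G H

open import Algebra.Morphism.Structures using (module GroupMorphisms)
open import Data.Product using (Σ)

_≅ᴳ_ : Group 0ℓ 0ℓ → Group 0ℓ 0ℓ → Set
G ≅ᴳ H = Σ (Group.Carrier G → Group.Carrier H)
           (GroupMorphisms.IsGroupIsomorphism (Group.rawGroup G) (Group.rawGroup H))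

-- Let x_{aj} be the edge of K_{3,n} joining the left vertex a to the right vertex j, and y_k
-- the added edges.  Every y_k is central in Γ(G): it commutes with the x_{aj} at its two
-- endpoints by the edge relations, hence with the third one of each column through the vertex
-- relation x_{0j} x_{1j} x_{2j} = 1 at the right vertex j, and with every y_{k′} because two
-- 2-subsets of a 3-set meet.  Sending x_{aj} ↦ (x_{aj}, τ_{aj}) and y_k ↦ (1, e_k) defines
-- ψ : Γ(G) → Γ(K_{3,n}) × ℤ₂^m, where τ_{a0} is the set of added edges at a and τ_{aj} = 0 for
-- j ≠ 0 (this is where n ≥ 1 is used): the vertex relation at a left vertex a holds because both
-- contributions equal that set, and at the right vertex 0 because each added edge meets exactly
-- two left vertices.  Centrality of the involutions y_k makes (x_{aj}, z) ↦ x_{aj} y^{τ_{aj}} y^z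
-- a well-defined inverse.

module Submission where

open import Defs
open import Level using (0ℓ)
open import Data.Nat using (ℕ; zero; suc; _+_; _*_; _≤_)
open import Data.Fin using (Fin; zero; suc; _↑ˡ_; _↑ʳ_; splitAt; remQuot; combine)
open import Data.Fin.Patterns using (0F; 1F; 2F)
open import Data.Fin.Properties using (_≟_; splitAt-↑ˡ; splitAt-↑ʳ; splitAt⁻¹-↑ˡ; splitAt⁻¹-↑ʳ; remQuot-combine; combine-remQuot)
open import Data.List using (List; []; _∷_; _++_; map; foldr; filter; tabulate; allFin)
open import Data.List.Properties using (filter-++; filter-≐; filter-none; map-tabulate)
import Data.List.Relation.Unary.All as All
open import Data.Bool using (Bool; true; false; if_then_else_; _xor_)
open import Data.Bool.Properties using (xor-comm; xor-same)
open import Data.Product using (_×_; _,_; proj₁; proj₂; ∃-syntax)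
open import Data.Sum using (_⊎_; inj₁; inj₂)
import Data.Sum as Sum
open import Data.Empty using (⊥-elim)
open import Data.Vec.Functional using (Vector)
open import Relation.Nullary using (Dec; does; yes; no; ¬_)
open import Relation.Nullary.Decidable using (_⊎-dec_)
open import Relation.Unary using (Pred; Decidable)
open import Relation.Binary.PropositionalEquality as ≡ using (_≡_; _≢_)
open import Function using (_∘_; id)
open import Algebra.Bundles using (Group; CommutativeMonoid)
import Algebra.Construct.DirectProduct as DP
open import Algebra.Morphism.Structures using (module GroupMorphisms)

filter-map : ∀ {A B : Set} {P : Pred A 0ℓ} (P? : Decidable P) (g : B → A) xs →
  filter P? (map g xs) ≡ map g (filter (P? ∘ g) xs)
filter-map P? g [] = ≡.refl
filter-map P? g (x ∷ xs) with does (P? (g x))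
... | true  = ≡.cong (g x ∷_) (filter-map P? g xs)
... | false = filter-map P? g xs

tabulate-+ : ∀ {A : Set} a b (t : Fin (a + b) → A) →
  tabulate t ≡ tabulate (t ∘ (_↑ˡ b)) ++ tabulate (t ∘ (a ↑ʳ_))
tabulate-+ zero    b t = ≡.refl
tabulate-+ (suc a) b t = ≡.cong (t zero ∷_) (tabulate-+ a b (t ∘ suc))

allFin-+ : ∀ a b → allFin (a + b) ≡ map (_↑ˡ b) (allFin a) ++ map (a ↑ʳ_) (allFin b)
allFin-+ a b = ≡.trans (tabulate-+ a b id)
  (≡.cong₂ _++_ (≡.sym (map-tabulate id (_↑ˡ b))) (≡.sym (map-tabulate id (a ↑ʳ_))))

Fin+-view : ∀ a b (x : Fin (a + b)) → (∃[ i ] x ≡ i ↑ˡ b) ⊎ (∃[ k ] x ≡ a ↑ʳ k)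
Fin+-view a b x with splitAt a x in eq
... | inj₁ i = inj₁ (i , ≡.sym (splitAt⁻¹-↑ˡ eq))
... | inj₂ k = inj₂ (k , ≡.sym (splitAt⁻¹-↑ʳ eq))

Fin3-cover : ∀ {p q : Fin 3} → p ≢ q → ∃[ r ] (∀ x → x ≡ p ⊎ x ≡ q ⊎ x ≡ r)
Fin3-cover {0F} {0F} p≢q = ⊥-elim (p≢q ≡.refl)
Fin3-cover {0F} {1F} _   = 2F , λ { 0F → inj₁ ≡.refl ; 1F → inj₂ (inj₁ ≡.refl) ; 2F → inj₂ (inj₂ ≡.refl) }
Fin3-cover {0F} {2F} _   = 1F , λ { 0F → inj₁ ≡.refl ; 1F → inj₂ (inj₂ ≡.refl) ; 2F → inj₂ (inj₁ ≡.refl) }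
Fin3-cover {1F} {0F} _   = 2F , λ { 0F → inj₂ (inj₁ ≡.refl) ; 1F → inj₁ ≡.refl ; 2F → inj₂ (inj₂ ≡.refl) }
Fin3-cover {1F} {1F} p≢q = ⊥-elim (p≢q ≡.refl)
Fin3-cover {1F} {2F} _   = 0F , λ { 0F → inj₂ (inj₂ ≡.refl) ; 1F → inj₁ ≡.refl ; 2F → inj₂ (inj₁ ≡.refl) }
Fin3-cover {2F} {0F} _   = 1F , λ { 0F → inj₂ (inj₁ ≡.refl) ; 1F → inj₂ (inj₂ ≡.refl) ; 2F → inj₁ ≡.refl }
Fin3-cover {2F} {1F} _   = 0F , λ { 0F → inj₂ (inj₂ ≡.refl) ; 1F → inj₂ (inj₁ ≡.refl) ; 2F → inj₁ ≡.refl }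
Fin3-cover {2F} {2F} p≢q = ⊥-elim (p≢q ≡.refl)

Fin3-outside-unique : ∀ {p q a b : Fin 3} → p ≢ q → a ≢ p → a ≢ q → b ≢ a → b ≡ p ⊎ b ≡ q
Fin3-outside-unique {p} {q} {a} {b} p≢q a≢p a≢q b≢a with Fin3-cover p≢q
... | r , cover with cover a | cover b
...   | inj₁ a≡p        | _               = ⊥-elim (a≢p a≡p)
...   | inj₂ (inj₁ a≡q) | _               = ⊥-elim (a≢q a≡q)
...   | inj₂ (inj₂ _)   | inj₁ b≡p        = inj₁ b≡p
...   | inj₂ (inj₂ _)   | inj₂ (inj₁ b≡q) = inj₂ b≡q
...   | inj₂ (inj₂ a≡r) | inj₂ (inj₂ b≡r) = ⊥-elim (b≢a (≡.trans b≡r (≡.sym a≡r)))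

Fin3-pairs-meet : ∀ {p q p′ q′ : Fin 3} → p ≢ q → p′ ≢ q′ →
  ∃[ v ] ((p ≡ v ⊎ q ≡ v) × (p′ ≡ v ⊎ q′ ≡ v))
Fin3-pairs-meet {p} {q} {p′} {q′} p≢q p′≢q′ with p′ ≟ p | p′ ≟ q
... | yes p′≡p | _        = p′ , inj₁ (≡.sym p′≡p) , inj₁ ≡.refl
... | no _     | yes p′≡q = p′ , inj₂ (≡.sym p′≡q) , inj₁ ≡.refl
... | no p′≢p  | no p′≢q with Fin3-outside-unique p≢q p′≢p p′≢q (p′≢q′ ∘ ≡.sym)
...   | inj₁ q′≡p = q′ , inj₁ (≡.sym q′≡p) , inj₂ ≡.refl
...   | inj₂ q′≡q = q′ , inj₂ (≡.sym q′≡q) , inj₂ ≡.refl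

module GroupProperties (H : Group 0ℓ 0ℓ) where
  open Group H
  open import Algebra.Properties.Group H using (inverseʳ-unique)
  open import Algebra.Properties.Monoid.Sum monoid public using (sum; sum-cong-≋; sum-replicate-zero)
  open import Relation.Binary.Reasoning.Setoid setoid

  Commute : Carrier → Carrier → Set
  Commute x y = x ∙ y ≈ y ∙ x

  commute-ε : ∀ x → Commute x ε
  commute-ε x = trans (identityʳ x) (sym (identityˡ x))

  commute-∙ : ∀ {x y z} → Commute x y → Commute x z → Commute x (y ∙ z)
  commute-∙ {x} {y} {z} xy xz = begin
    x ∙ (y ∙ z) ≈⟨ assoc x y z ⟨
    (x ∙ y) ∙ z ≈⟨ ∙-congʳ xy ⟩
    (y ∙ x) ∙ z ≈⟨ assoc y x z ⟩
    y ∙ (x ∙ z) ≈⟨ ∙-congˡ xz ⟩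
    y ∙ (z ∙ x) ≈⟨ assoc y z x ⟨
    (y ∙ z) ∙ x ∎

  commute-⁻¹ : ∀ {x y} → Commute x y → Commute x (y ⁻¹)
  commute-⁻¹ {x} {y} xy = begin
    x ∙ y ⁻¹                   ≈⟨ identityˡ _ ⟨
    ε ∙ (x ∙ y ⁻¹)             ≈⟨ ∙-congʳ (inverseˡ y) ⟨
    (y ⁻¹ ∙ y) ∙ (x ∙ y ⁻¹)    ≈⟨ assoc _ _ _ ⟩
    y ⁻¹ ∙ (y ∙ (x ∙ y ⁻¹))    ≈⟨ ∙-congˡ (assoc _ _ _) ⟨
    y ⁻¹ ∙ ((y ∙ x) ∙ y ⁻¹)    ≈⟨ ∙-congˡ (∙-congʳ xy) ⟨
    y ⁻¹ ∙ ((x ∙ y) ∙ y ⁻¹)    ≈⟨ ∙-congˡ (assoc _ _ _) ⟩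
    y ⁻¹ ∙ (x ∙ (y ∙ y ⁻¹))    ≈⟨ ∙-congˡ (∙-congˡ (inverseʳ y)) ⟩
    y ⁻¹ ∙ (x ∙ ε)             ≈⟨ ∙-congˡ (identityʳ x) ⟩
    y ⁻¹ ∙ x                   ∎

  commute-respʳ : ∀ {x y y′} → y ≈ y′ → Commute x y → Commute x y′
  commute-respʳ y≈y′ xy = trans (∙-congˡ (sym y≈y′)) (trans xy (∙-congʳ y≈y′))

  commute-third : ∀ {w x y z} → x ∙ (y ∙ z) ≈ ε → Commute w x → Commute w y → Commute w z
  commute-third {x = x} {y} {z} xyz≈ε wx wy = commute-respʳ (sym z≈[xy]⁻¹) (commute-⁻¹ (commute-∙ wx wy))
    where
    z≈[xy]⁻¹ : z ≈ (x ∙ y) ⁻¹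
    z≈[xy]⁻¹ = inverseʳ-unique (x ∙ y) z (trans (assoc x y z) xyz≈ε)

  rotate≈ε : ∀ {x y z} → x ∙ (y ∙ z) ≈ ε → y ∙ (z ∙ x) ≈ ε
  rotate≈ε {x} {y} {z} xyz≈ε = begin
    y ∙ (z ∙ x)  ≈⟨ assoc y z x ⟨
    (y ∙ z) ∙ x  ≈⟨ ∙-congʳ (inverseʳ-unique x (y ∙ z) xyz≈ε) ⟩
    x ⁻¹ ∙ x     ≈⟨ inverseˡ x ⟩
    ε            ∎

  interchange : ∀ {x y z w} → Commute y z → (x ∙ y) ∙ (z ∙ w) ≈ (x ∙ z) ∙ (y ∙ w)
  interchange {x} {y} {z} {w} yz = begin
    (x ∙ y) ∙ (z ∙ w)  ≈⟨ assoc x y (z ∙ w) ⟩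
    x ∙ (y ∙ (z ∙ w))  ≈⟨ ∙-congˡ (assoc y z w) ⟨
    x ∙ ((y ∙ z) ∙ w)  ≈⟨ ∙-congˡ (∙-congʳ yz) ⟩
    x ∙ ((z ∙ y) ∙ w)  ≈⟨ ∙-congˡ (assoc z y w) ⟩
    x ∙ (z ∙ (y ∙ w))  ≈⟨ assoc x z (y ∙ w) ⟨
    (x ∙ z) ∙ (y ∙ w)  ∎

  infixr 8 _^ᵇ_
  _^ᵇ_ : Carrier → Bool → Carrier
  x ^ᵇ b = if b then x else ε

  ^ᵇ-xor : ∀ {x} → x ∙ x ≈ ε → ∀ b b′ → x ^ᵇ (b xor b′) ≈ x ^ᵇ b ∙ x ^ᵇ b′
  ^ᵇ-xor x²≈ε true  true  = sym x²≈ε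
  ^ᵇ-xor x²≈ε true  false = sym (identityʳ _)
  ^ᵇ-xor x²≈ε false _     = sym (identityˡ _)

  ^ᵇ-commute : ∀ {x y} → Commute x y → ∀ b → Commute x (y ^ᵇ b)
  ^ᵇ-commute xy true  = xy
  ^ᵇ-commute xy false = commute-ε _

  ∏ : {A : Set} → (A → Carrier) → List A → Carrier
  ∏ g = foldr (λ x acc → g x ∙ acc) ε

  ∏-++ : ∀ {A : Set} (g : A → Carrier) xs ys → ∏ g (xs ++ ys) ≈ ∏ g xs ∙ ∏ g ys
  ∏-++ g []       ys = sym (identityˡ _)
  ∏-++ g (x ∷ xs) ys = trans (∙-congˡ (∏-++ g xs ys)) (sym (assoc _ _ _))

  ∏-map : ∀ {A B : Set} (g : A → Carrier) (h : B → A) xs → ∏ g (map h xs) ≡ ∏ (g ∘ h) xs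
  ∏-map g h []       = ≡.refl
  ∏-map g h (x ∷ xs) = ≡.cong (g (h x) ∙_) (∏-map g h xs)

  ∏-cong : ∀ {A : Set} {g g′ : A → Carrier} → (∀ x → g x ≈ g′ x) → ∀ xs → ∏ g xs ≈ ∏ g′ xs
  ∏-cong g≈g′ []       = refl
  ∏-cong g≈g′ (x ∷ xs) = ∙-cong (g≈g′ x) (∏-cong g≈g′ xs)

  ∏-ε : ∀ {A : Set} {g : A → Carrier} → (∀ x → g x ≈ ε) → ∀ xs → ∏ g xs ≈ ε
  ∏-ε g≈ε xs = trans (∏-cong g≈ε xs) (∏-trivial xs)
    where
    ∏-trivial : ∀ xs → ∏ (λ _ → ε) xs ≈ ε
    ∏-trivial []       = refl
    ∏-trivial (_ ∷ xs) = trans (identityˡ _) (∏-trivial xs)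

  ∏-filter : ∀ {A : Set} {P : Pred A 0ℓ} (g : A → Carrier) (P? : Decidable P) xs →
    ∏ g (filter P? xs) ≈ ∏ (λ x → g x ^ᵇ does (P? x)) xs
  ∏-filter g P? []       = refl
  ∏-filter g P? (x ∷ xs) with does (P? x)
  ... | true  = ∙-congˡ (∏-filter g P? xs)
  ... | false = trans (∏-filter g P? xs) (sym (identityˡ _))

  ∏-tabulate : ∀ {A : Set} (g : A → Carrier) k (t : Fin k → A) → ∏ g (tabulate t) ≡ sum (g ∘ t)
  ∏-tabulate g zero    t = ≡.refl
  ∏-tabulate g (suc k) t = ≡.cong (g (t zero) ∙_) (∏-tabulate g k (t ∘ suc))

  ∏-allFin : ∀ k (g : Fin k → Carrier) → ∏ g (allFin k) ≡ sum g
  ∏-allFin k g = ∏-tabulate g k id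

  sum-ε : ∀ k {t : Vector Carrier k} → (∀ i → t i ≈ ε) → sum t ≈ ε
  sum-ε k t≈ε = trans (sum-cong-≋ t≈ε) (sum-replicate-zero k)

  sum-+ : ∀ a b (t : Vector Carrier (a + b)) → sum t ≈ sum (t ∘ (_↑ˡ b)) ∙ sum (t ∘ (a ↑ʳ_))
  sum-+ zero    b t = sym (identityˡ _)
  sum-+ (suc a) b t = trans (∙-congˡ (sum-+ a b (t ∘ suc))) (sym (assoc _ _ _))

  sum-combine : ∀ k n (t : Vector Carrier (k * n)) →
    sum t ≈ sum (λ (a : Fin k) → sum (λ (j : Fin n) → t (combine a j)))
  sum-combine zero    n t = refl
  sum-combine (suc k) n t = trans (sum-+ n (k * n) t) (∙-congˡ (sum-combine k n (t ∘ (n ↑ʳ_))))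

  sum-^ᵇ : ∀ k (t : Vector Carrier k) b → sum (λ i → t i ^ᵇ b) ≈ sum t ^ᵇ b
  sum-^ᵇ k t true  = refl
  sum-^ᵇ k t false = sum-ε k (λ _ → refl)

  sum-single : ∀ k (t : Vector Carrier k) i → sum (λ j → t j ^ᵇ does (j ≟ i)) ≈ t i
  sum-single (suc k) t zero    = trans (∙-congˡ (sum-ε k (λ _ → refl))) (identityʳ _)
  sum-single (suc k) t (suc i) = trans (identityˡ _) (sum-single k (t ∘ suc) i)

  -- Evaluation of words, and the universal property of a presentation

  eval : {X : Set} → (X → Carrier) → Word X → Carrier
  eval g (gen x) = g x
  eval g e       = ε
  eval g (u · v) = eval g u ∙ eval g v
  eval g (inv u) = eval g u ⁻¹

  eval-foldr : ∀ {X : Set} (g : X → Carrier) xs → eval g (foldr (λ x w → gen x · w) e xs) ≡ ∏ g xs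
  eval-foldr g []       = ≡.refl
  eval-foldr g (x ∷ xs) = ≡.cong (g x ∙_) (eval-foldr g xs)

  module _ {X : Set} (R : Word X → Word X → Set) (g : X → Carrier)
           (respects : ∀ {u v} → R u v → eval g u ≈ eval g v) where
    open Presentation R using (_~_)

    eval-cong : ∀ {u v} → u ~ v → eval g u ≈ eval g v
    eval-cong _~_.~-refl          = refl
    eval-cong (_~_.~-sym p)       = sym (eval-cong p)
    eval-cong (_~_.~-trans p q)   = trans (eval-cong p) (eval-cong q)
    eval-cong (_~_.·-cong p q)    = ∙-cong (eval-cong p) (eval-cong q)
    eval-cong (_~_.inv-cong p)    = ⁻¹-cong (eval-cong p)
    eval-cong (_~_.assoc u v w)   = assoc _ _ _
    eval-cong (_~_.idˡ u)         = identityˡ _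
    eval-cong (_~_.idʳ u)         = identityʳ _
    eval-cong (_~_.invˡ u)        = inverseˡ _
    eval-cong (_~_.invʳ u)        = inverseʳ _
    eval-cong (_~_.rel r)         = respects r

-- The elementary abelian group ℤ₂^k and its homomorphisms

module Z (k : ℕ) = Group (ℤ₂^ k)

ℤ₂^-comm : ∀ k x y → Z._≈_ k (Z._∙_ k x y) (Z._∙_ k y x)
ℤ₂^-comm zero    x       y        = _
ℤ₂^-comm (suc k) (b , x) (b′ , y) = xor-comm b b′ , ℤ₂^-comm k x y

ℤ₂^-square : ∀ k x → Z._≈_ k (Z._∙_ k x x) (Z.ε k)
ℤ₂^-square zero    x       = _
ℤ₂^-square (suc k) (b , x) = xor-same b , ℤ₂^-square k x

ℤ₂^-inverse : ∀ k x → Z._≈_ k (Z._⁻¹ k x) x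
ℤ₂^-inverse zero    x       = _
ℤ₂^-inverse (suc k) (b , x) = ≡.refl , ℤ₂^-inverse k x

ℤ₂^-commutativeMonoid : ℕ → CommutativeMonoid 0ℓ 0ℓ
ℤ₂^-commutativeMonoid k = record
  { isCommutativeMonoid = record { isMonoid = Z.isMonoid k ; comm = ℤ₂^-comm k } }

basis : ∀ k → Fin k → Z.Carrier k
basis (suc k) zero    = true , Z.ε k
basis (suc k) (suc i) = false , basis k i

module Lift (H : Group 0ℓ 0ℓ) where
  open Group H
  open GroupProperties H

  lift : ∀ k → (Fin k → Carrier) → Z.Carrier k → Carrier
  lift zero    g _       = ε
  lift (suc k) g (b , z) = g zero ^ᵇ b ∙ lift k (g ∘ suc) z

  lift-cong : ∀ k (g : Fin k → Carrier) {z z′} → Z._≈_ k z z′ → lift k g z ≈ lift k g z′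
  lift-cong zero    g _              = refl
  lift-cong (suc k) g (≡.refl , z≈z′) = ∙-congˡ (lift-cong k (g ∘ suc) z≈z′)

  lift-congᵍ : ∀ k {g g′ : Fin k → Carrier} → (∀ i → g i ≈ g′ i) → ∀ z → lift k g z ≈ lift k g′ z
  lift-congᵍ zero    g≈g′ z           = refl
  lift-congᵍ (suc k) g≈g′ (true , z)  = ∙-cong (g≈g′ zero) (lift-congᵍ k (g≈g′ ∘ suc) z)
  lift-congᵍ (suc k) g≈g′ (false , z) = ∙-congˡ (lift-congᵍ k (g≈g′ ∘ suc) z)

  lift-trivial : ∀ k {g : Fin k → Carrier} → (∀ i → g i ≈ ε) → ∀ z → lift k g z ≈ ε
  lift-trivial zero    g≈ε z           = refl
  lift-trivial (suc k) g≈ε (true , z)  = trans (∙-cong (g≈ε zero) (lift-trivial k (g≈ε ∘ suc) z)) (identityˡ ε)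
  lift-trivial (suc k) g≈ε (false , z) = trans (identityˡ _) (lift-trivial k (g≈ε ∘ suc) z)

  lift-ε : ∀ k (g : Fin k → Carrier) → lift k g (Z.ε k) ≈ ε
  lift-ε zero    g = refl
  lift-ε (suc k) g = trans (identityˡ _) (lift-ε k (g ∘ suc))

  lift-basis : ∀ k (g : Fin k → Carrier) i → lift k g (basis k i) ≈ g i
  lift-basis (suc k) g zero    = trans (∙-congˡ (lift-ε k (g ∘ suc))) (identityʳ _)
  lift-basis (suc k) g (suc i) = trans (identityˡ _) (lift-basis k (g ∘ suc) i)

  lift-commute : ∀ k (g : Fin k → Carrier) {x} → (∀ i → Commute x (g i)) → ∀ z → Commute x (lift k g z)
  lift-commute zero    g xg z       = commute-ε _
  lift-commute (suc k) g xg (b , z) = commute-∙ (^ᵇ-commute (xg zero) b) (lift-commute k (g ∘ suc) (xg ∘ suc) z)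

  lift-∙ : ∀ k {g : Fin k → Carrier} → (∀ i j → Commute (g i) (g j)) → (∀ i → g i ∙ g i ≈ ε) →
    ∀ z z′ → lift k g (Z._∙_ k z z′) ≈ lift k g z ∙ lift k g z′
  lift-∙ zero    _  _  _       _         = sym (identityˡ ε)
  lift-∙ (suc k) {g} gg g² (b , z) (b′ , z′) = begin
    g₀ ^ᵇ (b xor b′) ∙ lift k (g ∘ suc) (Z._∙_ k z z′)
      ≈⟨ ∙-cong (^ᵇ-xor (g² zero) b b′) (lift-∙ k (λ i j → gg (suc i) (suc j)) (g² ∘ suc) z z′) ⟩
    (g₀ ^ᵇ b ∙ g₀ ^ᵇ b′) ∙ (lift k (g ∘ suc) z ∙ lift k (g ∘ suc) z′)
      ≈⟨ interchange (^ᵇ-commute (sym (lift-commute k (g ∘ suc) (gg zero ∘ suc) z)) b′) ⟨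
    (g₀ ^ᵇ b ∙ lift k (g ∘ suc) z) ∙ (g₀ ^ᵇ b′ ∙ lift k (g ∘ suc) z′) ∎
    where
    g₀ = g zero
    open import Relation.Binary.Reasoning.Setoid setoid

  lift-∏ : ∀ k {g : Fin k → Carrier} → (∀ i j → Commute (g i) (g j)) → (∀ i → g i ∙ g i ≈ ε) →
    ∀ {A : Set} (q : A → Z.Carrier k) xs → lift k g (GroupProperties.∏ (ℤ₂^ k) q xs) ≈ ∏ (lift k g ∘ q) xs
  lift-∏ k {g} gg g² q []       = lift-ε k g
  lift-∏ k {g} gg g² q (x ∷ xs) = trans (lift-∙ k gg g² (q x) _) (∙-congˡ (lift-∏ k gg g² q xs))

module _ (H : Group 0ℓ 0ℓ) {X : Set} (R : Word X → Word X → Set) where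
  open Group H
  open GroupProperties H using (eval)
  open Lift H using (lift)
  private module W = Lift (Presentation.group R)

  eval-lift : ∀ (q : X → Carrier) k (w : Fin k → Word X) z → eval q (W.lift k w z) ≈ lift k (eval q ∘ w) z
  eval-lift q zero    w z           = refl
  eval-lift q (suc k) w (true , z)  = ∙-congˡ (eval-lift q k (w ∘ suc) z)
  eval-lift q (suc k) w (false , z) = ∙-congˡ (eval-lift q k (w ∘ suc) z)

module DirectProduct (A B : Group 0ℓ 0ℓ) where
  private
    module A = Group A
    module B = Group B
    module A×B = Group (DP.group A B)
    module ∏A = GroupProperties A
    module ∏B = GroupProperties B
    module ∏A×B = GroupProperties (DP.group A B)
    module LA = Lift A
    module LB = Lift B
    module LA×B = Lift (DP.group A B)

  ∏-pair : ∀ {X : Set} (q : X → A×B.Carrier) xs →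
    ∏A×B.∏ q xs A×B.≈ (∏A.∏ (proj₁ ∘ q) xs , ∏B.∏ (proj₂ ∘ q) xs)
  ∏-pair q []       = A.refl , B.refl
  ∏-pair q (x ∷ xs) = A×B.∙-congˡ {q x} (∏-pair q xs)

  lift-pair : ∀ k (g : Fin k → A×B.Carrier) z →
    LA×B.lift k g z A×B.≈ (LA.lift k (proj₁ ∘ g) z , LB.lift k (proj₂ ∘ g) z)
  lift-pair zero    g z           = A.refl , B.refl
  lift-pair (suc k) g (true , z)  = A×B.∙-congˡ {g zero} (lift-pair k (g ∘ suc) z)
  lift-pair (suc k) g (false , z) = A×B.∙-congˡ {A×B.ε} (lift-pair k (g ∘ suc) z)

lift-basis-id : ∀ k z → Z._≈_ k (Lift.lift (ℤ₂^ k) k (basis k) z) z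
lift-basis-id zero    z       = _
lift-basis-id (suc k) (b , z) = Z.trans (suc k) (Z.∙-congˡ (suc k) {basis (suc k) zero ^ᵇ b} tail≈) (head≈ b)
  where
  open GroupProperties (ℤ₂^ (suc k)) using (_^ᵇ_)
  tail≈ : Z._≈_ (suc k) (Lift.lift (ℤ₂^ (suc k)) k (λ i → false , basis k i) z) (false , z)
  tail≈ = Z.trans (suc k) (DirectProduct.lift-pair ℤ₂ (ℤ₂^ k) k _ z)
            (Lift.lift-trivial ℤ₂ k (λ _ → ≡.refl) z , lift-basis-id k z)
  head≈ : ∀ b → Z._≈_ (suc k) (Z._∙_ (suc k) (basis (suc k) zero ^ᵇ b) (false , z)) (b , z)
  head≈ true  = ≡.refl , Z.identityˡ k z
  head≈ false = ≡.refl , Z.identityˡ k z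

-- Edges at a vertex of K_{3,n}

module Bipartite (n : ℕ) where

  edge : Fin 3 → Fin n → Fin (3 * n)
  edge = combine

  left right : Fin (3 * n) → Fin (3 + n)
  left  i = proj₁ (remQuot {3} n i) ↑ˡ n
  right i = 3 ↑ʳ proj₂ (remQuot {3} n i)

  meets? : ∀ v i → Dec ((left i ≡ v) ⊎ (right i ≡ v))
  meets? v i = (left i ≟ v) ⊎-dec (right i ≟ v)

  bipartiteEdgesAt : Fin (3 + n) → List (Fin (3 * n))
  bipartiteEdgesAt v = filter (meets? v) (allFin (3 * n))

  left-edge : ∀ a j → left (edge a j) ≡ a ↑ˡ n
  left-edge a j = ≡.cong (λ r → proj₁ r ↑ˡ n) (remQuot-combine a j)

  left≢right : ∀ (a : Fin 3) (j : Fin n) → a ↑ˡ n ≢ 3 ↑ʳ j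
  left≢right 0F j ()
  left≢right 1F j ()
  left≢right 2F j ()

  private
    meets-combine : ∀ v (a : Fin 3) (j : Fin n) → does (meets? v (edge a j)) ≡ does ((a ↑ˡ n ≟ v) ⊎-dec (3 ↑ʳ j ≟ v))
    meets-combine v a j = ≡.cong (λ r → does ((proj₁ r ↑ˡ n ≟ v) ⊎-dec (3 ↑ʳ proj₂ r ≟ v))) (remQuot-combine a j)

    meets-left : ∀ (a a′ : Fin 3) (j : Fin n) → does ((a ↑ˡ n ≟ a′ ↑ˡ n) ⊎-dec (3 ↑ʳ j ≟ a′ ↑ˡ n)) ≡ does (a ≟ a′)
    meets-left 0F 0F j = ≡.refl
    meets-left 0F 1F j = ≡.refl
    meets-left 0F 2F j = ≡.refl
    meets-left 1F 0F j = ≡.refl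
    meets-left 1F 1F j = ≡.refl
    meets-left 1F 2F j = ≡.refl
    meets-left 2F 0F j = ≡.refl
    meets-left 2F 1F j = ≡.refl
    meets-left 2F 2F j = ≡.refl

    meets-right : ∀ (a : Fin 3) (j j′ : Fin n) → does ((a ↑ˡ n ≟ 3 ↑ʳ j′) ⊎-dec (3 ↑ʳ j ≟ 3 ↑ʳ j′)) ≡ does (j ≟ j′)
    meets-right 0F j j′ = ≡.refl
    meets-right 1F j j′ = ≡.refl
    meets-right 2F j j′ = ≡.refl

  module _ (H : Group 0ℓ 0ℓ) (q : Fin (3 * n) → Group.Carrier H) where
    open Group H
    open GroupProperties H

    ∏-bipartiteEdgesAt : ∀ v → ∏ q (bipartiteEdgesAt v) ≈
      sum (λ (a : Fin 3) → sum (λ j → q (edge a j) ^ᵇ does ((a ↑ˡ n ≟ v) ⊎-dec (3 ↑ʳ j ≟ v))))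
    ∏-bipartiteEdgesAt v =
      trans (∏-filter q (meets? v) (allFin (3 * n)))
      (trans (reflexive (∏-allFin (3 * n) _))
      (trans (sum-combine 3 n _)
             (sum-cong-≋ {3} λ a → sum-cong-≋ {n} λ j → reflexive (≡.cong (q (edge a j) ^ᵇ_) (meets-combine v a j)))))

    ∏-bipartiteEdgesAt-left : ∀ a → ∏ q (bipartiteEdgesAt (a ↑ˡ n)) ≈ sum (λ j → q (edge a j))
    ∏-bipartiteEdgesAt-left a′ =
      trans (∏-bipartiteEdgesAt (a′ ↑ˡ n))
            (trans (sum-cong-≋ {3} row) (sum-single 3 (λ a → sum (λ j → q (edge a j))) a′))
      where
      row : ∀ a → sum (λ j → q (edge a j) ^ᵇ does ((a ↑ˡ n ≟ a′ ↑ˡ n) ⊎-dec (3 ↑ʳ j ≟ a′ ↑ˡ n)))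
                  ≈ sum (λ j → q (edge a j)) ^ᵇ does (a ≟ a′)
      row a = trans (sum-cong-≋ {n} λ j → reflexive (≡.cong (q (edge a j) ^ᵇ_) (meets-left a a′ j)))
                    (sum-^ᵇ n (λ j → q (edge a j)) (does (a ≟ a′)))

    ∏-bipartiteEdgesAt-right : ∀ j → ∏ q (bipartiteEdgesAt (3 ↑ʳ j)) ≈ sum (λ (a : Fin 3) → q (edge a j))
    ∏-bipartiteEdgesAt-right j′ = trans (∏-bipartiteEdgesAt (3 ↑ʳ j′)) (sum-cong-≋ {3} column)
      where
      column : ∀ a → sum (λ j → q (edge a j) ^ᵇ does ((a ↑ˡ n ≟ 3 ↑ʳ j′) ⊎-dec (3 ↑ʳ j ≟ 3 ↑ʳ j′)))
                     ≈ q (edge a j′)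
      column a = trans (sum-cong-≋ {n} λ j → reflexive (≡.cong (q (edge a j) ^ᵇ_) (meets-right a j j′)))
                       (sum-single n (λ j → q (edge a j)) j′)

module Incidence (n m : ℕ) (f : Fin m → Fin 3 × Fin 3) where
  open Bipartite n

  G : Graph
  G = K3n+ n m f

  src-bipartite : ∀ i → Graph.src G (i ↑ˡ m) ≡ left i
  src-bipartite i rewrite splitAt-↑ˡ (3 * n) i m = ≡.refl

  tgt-bipartite : ∀ i → Graph.tgt G (i ↑ˡ m) ≡ right i
  tgt-bipartite i rewrite splitAt-↑ˡ (3 * n) i m = ≡.refl

  src-added : ∀ k → Graph.src G ((3 * n) ↑ʳ k) ≡ proj₁ (f k) ↑ˡ n
  src-added k rewrite splitAt-↑ʳ (3 * n) m k = ≡.refl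

  tgt-added : ∀ k → Graph.tgt G ((3 * n) ↑ʳ k) ≡ proj₂ (f k) ↑ˡ n
  tgt-added k rewrite splitAt-↑ʳ (3 * n) m k = ≡.refl

  incident-bipartite : ∀ {v i} → Incident G v (i ↑ˡ m) → (left i ≡ v) ⊎ (right i ≡ v)
  incident-bipartite {i = i} (inj₁ s≡v) = inj₁ (≡.trans (≡.sym (src-bipartite i)) s≡v)
  incident-bipartite {i = i} (inj₂ t≡v) = inj₂ (≡.trans (≡.sym (tgt-bipartite i)) t≡v)

  bipartite-incident : ∀ {v i} → (left i ≡ v) ⊎ (right i ≡ v) → Incident G v (i ↑ˡ m)
  bipartite-incident {i = i} (inj₁ l≡v) = inj₁ (≡.trans (src-bipartite i) l≡v)
  bipartite-incident {i = i} (inj₂ r≡v) = inj₂ (≡.trans (tgt-bipartite i) r≡v)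

  added-incident : ∀ k {a} → (proj₁ (f k) ≡ a) ⊎ (proj₂ (f k) ≡ a) → Incident G (a ↑ˡ n) ((3 * n) ↑ʳ k)
  added-incident k (inj₁ p≡a) = inj₁ (≡.trans (src-added k) (≡.cong (_↑ˡ n) p≡a))
  added-incident k (inj₂ q≡a) = inj₂ (≡.trans (tgt-added k) (≡.cong (_↑ˡ n) q≡a))

  addedEdgesAt : Fin (3 + n) → List (Fin m)
  addedEdgesAt v = filter (incident? G v ∘ ((3 * n) ↑ʳ_)) (allFin m)

  addedEdgesAt-right : ∀ j → addedEdgesAt (3 ↑ʳ j) ≡ []
  addedEdgesAt-right j = filter-none (incident? G (3 ↑ʳ j) ∘ ((3 * n) ↑ʳ_)) (All.universal not-incident (allFin m))
    where
    not-incident : ∀ k → ¬ Incident G (3 ↑ʳ j) ((3 * n) ↑ʳ k)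
    not-incident k (inj₁ s≡v) = left≢right (proj₁ (f k)) j (≡.trans (≡.sym (src-added k)) s≡v)
    not-incident k (inj₂ t≡v) = left≢right (proj₂ (f k)) j (≡.trans (≡.sym (tgt-added k)) t≡v)

  -- an added edge joins two of the three left vertices, so it is incident to an even number of them
  added-edge-parity : ∀ k → proj₁ (f k) ≢ proj₂ (f k) →
    let meets a = does (incident? G (a ↑ˡ n) ((3 * n) ↑ʳ k))
    in meets 0F xor (meets 1F xor meets 2F) ≡ false
  added-edge-parity k p≢q rewrite src-added k | tgt-added k = parity (proj₁ (f k)) (proj₂ (f k)) p≢q
    where
    parity : ∀ p q → p ≢ q →
      let meets a = does ((p ↑ˡ n ≟ a ↑ˡ n) ⊎-dec (q ↑ˡ n ≟ a ↑ˡ n))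
      in meets 0F xor (meets 1F xor meets 2F) ≡ false
    parity 0F 0F p≢q = ⊥-elim (p≢q ≡.refl)
    parity 0F 1F _   = ≡.refl
    parity 0F 2F _   = ≡.refl
    parity 1F 0F _   = ≡.refl
    parity 1F 1F p≢q = ⊥-elim (p≢q ≡.refl)
    parity 1F 2F _   = ≡.refl
    parity 2F 0F _   = ≡.refl
    parity 2F 1F _   = ≡.refl
    parity 2F 2F p≢q = ⊥-elim (p≢q ≡.refl)

  edgesAt-split : ∀ v → edgesAt G v ≡ map (_↑ˡ m) (bipartiteEdgesAt v) ++ map ((3 * n) ↑ʳ_) (addedEdgesAt v)
  edgesAt-split v = begin
    filter P? (allFin (3 * n + m))
      ≡⟨ ≡.cong (filter P?) (allFin-+ (3 * n) m) ⟩
    filter P? (map (_↑ˡ m) (allFin (3 * n)) ++ map ((3 * n) ↑ʳ_) (allFin m))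
      ≡⟨ filter-++ P? (map (_↑ˡ m) (allFin (3 * n))) (map ((3 * n) ↑ʳ_) (allFin m)) ⟩
    filter P? (map (_↑ˡ m) (allFin (3 * n))) ++ filter P? (map ((3 * n) ↑ʳ_) (allFin m))
      ≡⟨ ≡.cong₂ _++_ (filter-map P? (_↑ˡ m) (allFin (3 * n))) (filter-map P? ((3 * n) ↑ʳ_) (allFin m)) ⟩
    map (_↑ˡ m) (filter (P? ∘ (_↑ˡ m)) (allFin (3 * n))) ++ map ((3 * n) ↑ʳ_) (addedEdgesAt v)
      ≡⟨ ≡.cong (λ es → map (_↑ˡ m) es ++ map ((3 * n) ↑ʳ_) (addedEdgesAt v)) bipartite-part ⟩
    map (_↑ˡ m) (bipartiteEdgesAt v) ++ map ((3 * n) ↑ʳ_) (addedEdgesAt v) ∎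
    where
    open ≡.≡-Reasoning
    P? = incident? G v
    bipartite-part : filter (P? ∘ (_↑ˡ m)) (allFin (3 * n)) ≡ bipartiteEdgesAt v
    bipartite-part = filter-≐ (P? ∘ (_↑ˡ m)) (meets? v) (incident-bipartite , bipartite-incident) (allFin (3 * n))

  module _ (H : Group 0ℓ 0ℓ) (q : Fin (3 * n + m) → Group.Carrier H) where
    open Group H
    open GroupProperties H

    ∏-edgesAt : ∀ v → ∏ q (edgesAt G v) ≈
      ∏ (q ∘ (_↑ˡ m)) (bipartiteEdgesAt v) ∙ ∏ (q ∘ ((3 * n) ↑ʳ_)) (addedEdgesAt v)
    ∏-edgesAt v =
      trans (reflexive (≡.cong (∏ q) (edgesAt-split v)))
      (trans (∏-++ q (map (_↑ˡ m) (bipartiteEdgesAt v)) (map ((3 * n) ↑ʳ_) (addedEdgesAt v)))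
             (reflexive (≡.cong₂ _∙_ (∏-map q (_↑ˡ m) (bipartiteEdgesAt v)) (∏-map q ((3 * n) ↑ʳ_) (addedEdgesAt v)))))

-- The isomorphism Γ(G) ≅ Γ(K_{3,n}) × ℤ₂^m

module Isomorphism (n′ m : ℕ) (f : Fin m → Fin 3 × Fin 3) (f-loopless : ∀ k → proj₁ (f k) ≢ proj₂ (f k)) where
  n : ℕ
  n = suc n′

  open Bipartite n
  open Incidence n m f

  K : Graph
  K = K3n n

  T : Group 0ℓ 0ℓ
  T = Γ K ×ᴳ ℤ₂^ m

  module ΓG = Group (Γ G)
  module ΓK = Group (Γ K)
  module T = Group T
  module Zm = Z m
  module PG = GroupProperties (Γ G)
  module PK = GroupProperties (Γ K)
  module PT = GroupProperties T
  module PZ = GroupProperties (ℤ₂^ m)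
  open PG using (Commute; commute-ε; commute-∙; commute-⁻¹; commute-third; rotate≈ε; interchange; ∏)
  open Presentation using (rel)

  x : Fin (3 * n) → Word (Fin (3 * n + m))
  x i = gen (i ↑ˡ m)

  y : Fin m → Word (Fin (3 * n + m))
  y k = gen ((3 * n) ↑ʳ k)

  vertex-relation : ∀ v → ∏ x (bipartiteEdgesAt v) · ∏ y (addedEdgesAt v) ΓG.≈ e
  vertex-relation v = ΓG.trans (ΓG.sym (∏-edgesAt (Γ G) gen v)) (rel (vertex v))

  column-relation : ∀ j → x (edge 0F j) · (x (edge 1F j) · x (edge 2F j)) ΓG.≈ e
  column-relation j = begin
    x₀ · (x₁ · x₂)                   ≈⟨ ΓG.∙-congˡ (ΓG.∙-congˡ (ΓG.identityʳ x₂)) ⟨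
    x₀ · (x₁ · (x₂ · e))             ≈⟨ ∏-bipartiteEdgesAt-right (Γ G) x j ⟨
    ∏ x column                       ≈⟨ ΓG.identityʳ _ ⟨
    ∏ x column · ∏ y []              ≡⟨ ≡.cong (λ ks → ∏ x column · ∏ y ks) (addedEdgesAt-right j) ⟨
    ∏ x column · ∏ y (addedEdgesAt v) ≈⟨ vertex-relation v ⟩
    e                                ∎
    where
    open import Relation.Binary.Reasoning.Setoid ΓG.setoid
    v = 3 ↑ʳ j
    column = bipartiteEdgesAt v
    x₀ = x (edge 0F j)
    x₁ = x (edge 1F j)
    x₂ = x (edge 2F j)

  column-commute : ∀ {w} a j → (∀ b → b ≢ a → Commute w (x (edge b j))) → Commute w (x (edge a j))
  column-commute 0F j w-x = commute-third (rotate≈ε (column-relation j)) (w-x 1F λ ()) (w-x 2F λ ())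
  column-commute 1F j w-x = commute-third (rotate≈ε (rotate≈ε (column-relation j))) (w-x 2F λ ()) (w-x 0F λ ())
  column-commute 2F j w-x = commute-third (column-relation j) (w-x 0F λ ()) (w-x 1F λ ())

  module _ (k : Fin m) where
    private
      p = proj₁ (f k)
      q = proj₂ (f k)

    added-commute-at : ∀ a j → a ≡ p ⊎ a ≡ q → Commute (y k) (x (edge a j))
    added-commute-at a j a∈pq = ΓG.sym (rel (commute (a ↑ˡ n) (edge a j ↑ˡ m) ((3 * n) ↑ʳ k)
      (bipartite-incident {i = edge a j} (inj₁ (left-edge a j))) (added-incident k (Sum.map ≡.sym ≡.sym a∈pq))))

    -- the added edge k = {p, q} meets the column of j at p and q, and the column relation gives the third edge
    added-commute-bipartite : ∀ a j → Commute (y k) (x (edge a j))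
    added-commute-bipartite a j with a ≟ p | a ≟ q
    ... | yes a≡p | _        = added-commute-at a j (inj₁ a≡p)
    ... | no _    | yes a≡q  = added-commute-at a j (inj₂ a≡q)
    ... | no a≢p  | no a≢q   = column-commute a j λ b b≢a →
      added-commute-at b j (Fin3-outside-unique (f-loopless k) a≢p a≢q b≢a)

    added-commute-gen : ∀ ed → Commute (y k) (gen ed)
    added-commute-gen ed with Fin+-view (3 * n) m ed
    ... | inj₁ (i , ≡.refl) = ≡.subst (Commute (y k) ∘ x) (combine-remQuot {3} n i)
      (added-commute-bipartite (proj₁ (remQuot {3} n i)) (proj₂ (remQuot {3} n i)))
    ... | inj₂ (k′ , ≡.refl) with Fin3-pairs-meet (f-loopless k) (f-loopless k′)
    ...   | v , k∋v , k′∋v = rel (commute (v ↑ˡ n) ((3 * n) ↑ʳ k) ((3 * n) ↑ʳ k′)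
      (added-incident k k∋v) (added-incident k′ k′∋v))

    added-central : ∀ w → Commute (y k) w
    added-central (gen ed) = added-commute-gen ed
    added-central e        = commute-ε (y k)
    added-central (u · v)  = commute-∙ (added-central u) (added-central v)
    added-central (inv u)  = commute-⁻¹ (added-central u)

  open Lift (Γ G) using (lift; lift-cong; lift-ε; lift-basis; lift-commute; lift-∙; lift-∏)

  y-commute : ∀ k k′ → Commute (y k) (y k′)
  y-commute k k′ = added-central k (y k′)

  ŷ : Zm.Carrier → Word (Fin (3 * n + m))
  ŷ = lift m y

  ŷ-central : ∀ w z → Commute w (ŷ z)
  ŷ-central w = lift-commute m y (λ k → ΓG.sym (added-central k w))

  ŷ-∙ : ∀ z z′ → ŷ (Zm._∙_ z z′) ΓG.≈ ŷ z · ŷ z′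
  ŷ-∙ = lift-∙ m y-commute (λ k → rel (square _))

  ŷ-∏ : ∀ {A : Set} (t : A → Zm.Carrier) xs → ŷ (PZ.∏ t xs) ΓG.≈ ∏ (ŷ ∘ t) xs
  ŷ-∏ = lift-∏ m y-commute (λ k → rel (square _))

  ŷ-square : ∀ z → ŷ z · ŷ z ΓG.≈ e
  ŷ-square z = ΓG.trans (ΓG.sym (ŷ-∙ z z)) (ΓG.trans (lift-cong m y (ℤ₂^-square m z)) (lift-ε m y))

  addedAt : Fin 3 → Zm.Carrier
  addedAt a = PZ.∏ (basis m) (addedEdgesAt (a ↑ˡ n))

  addedAt-sum : PZ.sum addedAt Zm.≈ Zm.ε
  addedAt-sum = begin
    PZ.sum addedAt                                       ≈⟨ PZ.sum-cong-≋ {3} addedAt-as-sum ⟩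
    PZ.sum (λ a → PZ.sum (λ k → basis m k ^ᵇ meets a k)) ≈⟨ ∑-comm (λ a k → basis m k ^ᵇ meets a k) ⟩
    PZ.sum (λ k → PZ.sum (λ a → basis m k ^ᵇ meets a k)) ≈⟨ PZ.sum-ε m column ⟩
    Zm.ε                                                 ∎
    where
    open import Relation.Binary.Reasoning.Setoid Zm.setoid
    open import Algebra.Properties.CommutativeMonoid.Sum (ℤ₂^-commutativeMonoid m) using (∑-comm)
    open PZ using (_^ᵇ_; ^ᵇ-xor)
    meets : Fin 3 → Fin m → Bool
    meets a k = does (incident? G (a ↑ˡ n) ((3 * n) ↑ʳ k))
    addedAt-as-sum : ∀ a → addedAt a Zm.≈ PZ.sum (λ k → basis m k ^ᵇ meets a k)
    addedAt-as-sum a = Zm.trans (PZ.∏-filter (basis m) _ (allFin m)) (Zm.reflexive (PZ.∏-allFin m _))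
    column : ∀ k → PZ.sum (λ a → basis m k ^ᵇ meets a k) Zm.≈ Zm.ε
    column k = begin
      b ^ᵇ meets 0F k ∙ (b ^ᵇ meets 1F k ∙ (b ^ᵇ meets 2F k ∙ Zm.ε))
        ≈⟨ Zm.∙-congˡ (Zm.∙-congˡ (Zm.identityʳ _)) ⟩
      b ^ᵇ meets 0F k ∙ (b ^ᵇ meets 1F k ∙ b ^ᵇ meets 2F k)
        ≈⟨ Zm.∙-congˡ (^ᵇ-xor b² _ _) ⟨
      b ^ᵇ meets 0F k ∙ b ^ᵇ (meets 1F k xor meets 2F k)
        ≈⟨ ^ᵇ-xor b² _ _ ⟨
      b ^ᵇ (meets 0F k xor (meets 1F k xor meets 2F k))
        ≡⟨ ≡.cong (b ^ᵇ_) (added-edge-parity k (f-loopless k)) ⟩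
      Zm.ε ∎
      where
      b = basis m k
      b² = ℤ₂^-square m b
      open Zm using (_∙_)

  τ′ : Fin 3 → Fin n → Zm.Carrier
  τ′ a zero    = addedAt a
  τ′ a (suc _) = Zm.ε

  τ : Fin (3 * n) → Zm.Carrier
  τ i = τ′ (proj₁ (remQuot {3} n i)) (proj₂ (remQuot {3} n i))

  τ-edge : ∀ a j → τ (edge a j) ≡ τ′ a j
  τ-edge a j = ≡.cong (λ r → τ′ (proj₁ r) (proj₂ r)) (remQuot-combine a j)

  ∏-τ : ∀ v → PZ.∏ τ (bipartiteEdgesAt v) Zm.≈ PZ.∏ (basis m) (addedEdgesAt v)
  ∏-τ v with Fin+-view 3 n v
  ... | inj₁ (a , ≡.refl) =
    Zm.trans (∏-bipartiteEdgesAt-left (ℤ₂^ m) τ a)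
    (Zm.trans (PZ.sum-cong-≋ {n} (Zm.reflexive ∘ τ-edge a))
              (Zm.trans (Zm.∙-congˡ (PZ.sum-ε n′ (λ _ → Zm.refl))) (Zm.identityʳ _)))
  ... | inj₂ (j , ≡.refl) =
    Zm.trans (∏-bipartiteEdgesAt-right (ℤ₂^ m) τ j)
    (Zm.trans (PZ.sum-cong-≋ {3} (λ a → Zm.reflexive (τ-edge a j)))
    (Zm.trans (column-τ j) (Zm.reflexive (≡.cong (PZ.∏ (basis m)) (≡.sym (addedEdgesAt-right j))))))
    where
    column-τ : ∀ j → PZ.sum (λ a → τ′ a j) Zm.≈ Zm.ε
    column-τ zero    = addedAt-sum
    column-τ (suc j) = PZ.sum-ε 3 (λ _ → Zm.refl)

  open DirectProduct (Γ K) (ℤ₂^ m) using (∏-pair; lift-pair)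
  module IK = Incidence n 0 (λ ())

  xᴷ : Fin (3 * n) → Word (Fin (3 * n + 0))
  xᴷ i = gen (i ↑ˡ 0)

  vertex-relationᴷ : ∀ v → PK.∏ xᴷ (bipartiteEdgesAt v) ΓK.≈ e
  vertex-relationᴷ v =
    ΓK.trans (ΓK.sym (ΓK.identityʳ _)) (ΓK.trans (ΓK.sym (IK.∏-edgesAt (Γ K) gen v)) (rel (vertex v)))

  ψ-gen′ : Fin (3 * n) ⊎ Fin m → T.Carrier
  ψ-gen′ (inj₁ i) = xᴷ i , τ i
  ψ-gen′ (inj₂ k) = e , basis m k

  ψ-gen : Fin (3 * n + m) → T.Carrier
  ψ-gen = ψ-gen′ ∘ splitAt (3 * n)

  ψ-gen-bipartite : ∀ i → ψ-gen (i ↑ˡ m) ≡ (xᴷ i , τ i)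
  ψ-gen-bipartite i = ≡.cong ψ-gen′ (splitAt-↑ˡ (3 * n) i m)

  ψ-gen-added : ∀ k → ψ-gen ((3 * n) ↑ʳ k) ≡ (e , basis m k)
  ψ-gen-added k = ≡.cong ψ-gen′ (splitAt-↑ʳ (3 * n) m k)

  ψ : Word (Fin (3 * n + m)) → T.Carrier
  ψ = PT.eval ψ-gen

  ψ-∏-bipartite : ∀ is → PT.∏ (ψ-gen ∘ (_↑ˡ m)) is T.≈ (PK.∏ xᴷ is , PZ.∏ τ is)
  ψ-∏-bipartite is = T.trans (∏-pair (ψ-gen ∘ (_↑ˡ m)) is)
    ( PK.∏-cong (λ i → ΓK.reflexive (≡.cong proj₁ (ψ-gen-bipartite i))) is
    , PZ.∏-cong (λ i → Zm.reflexive (≡.cong proj₂ (ψ-gen-bipartite i))) is)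

  ψ-∏-added : ∀ ks → PT.∏ (ψ-gen ∘ ((3 * n) ↑ʳ_)) ks T.≈ (e , PZ.∏ (basis m) ks)
  ψ-∏-added ks = T.trans (∏-pair (ψ-gen ∘ ((3 * n) ↑ʳ_)) ks)
    ( PK.∏-ε (λ k → ΓK.reflexive (≡.cong proj₁ (ψ-gen-added k))) ks
    , PZ.∏-cong (λ k → Zm.reflexive (≡.cong proj₂ (ψ-gen-added k))) ks)

  ψ-vertex : ∀ v → ψ (vertexProduct G v) T.≈ T.ε
  ψ-vertex v = begin
    ψ (vertexProduct G v)                                    ≡⟨ PT.eval-foldr ψ-gen (edgesAt G v) ⟩
    PT.∏ ψ-gen (edgesAt G v)                                 ≈⟨ ∏-edgesAt T ψ-gen v ⟩
    PT.∏ (ψ-gen ∘ (_↑ˡ m)) LK ∙ PT.∏ (ψ-gen ∘ ((3 * n) ↑ʳ_)) AG ≈⟨ T.∙-cong (ψ-∏-bipartite LK) (ψ-∏-added AG) ⟩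
    (PK.∏ xᴷ LK · e , Zm._∙_ (PZ.∏ τ LK) (PZ.∏ (basis m) AG))
      ≈⟨ ΓK.trans (ΓK.identityʳ _) (vertex-relationᴷ v) , Zm.trans (Zm.∙-congʳ (∏-τ v)) (ℤ₂^-square m _) ⟩
    T.ε                                                      ∎
    where
    open import Relation.Binary.Reasoning.Setoid T.setoid
    open T using (_∙_)
    LK = bipartiteEdgesAt v
    AG = addedEdgesAt v

  ψ-respects : ∀ {u v} → ΓRel G u v → ψ u T.≈ ψ v
  ψ-respects (square ed) with Fin+-view (3 * n) m ed
  ... | inj₁ (i , ≡.refl) rewrite ψ-gen-bipartite i = rel (square (i ↑ˡ 0)) , ℤ₂^-square m (τ i)
  ... | inj₂ (k , ≡.refl) rewrite ψ-gen-added k     = ΓK.identityˡ e , ℤ₂^-square m (basis m k)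
  ψ-respects (commute v ed ed′ ed∋v ed′∋v) with Fin+-view (3 * n) m ed | Fin+-view (3 * n) m ed′
  ... | inj₁ (i , ≡.refl) | inj₁ (i′ , ≡.refl) rewrite ψ-gen-bipartite i | ψ-gen-bipartite i′ =
    rel (commute v (i ↑ˡ 0) (i′ ↑ˡ 0)
      (IK.bipartite-incident {i = i} (incident-bipartite {i = i} ed∋v))
      (IK.bipartite-incident {i = i′} (incident-bipartite {i = i′} ed′∋v)))
    , ℤ₂^-comm m _ _
  ... | inj₁ (i , ≡.refl) | inj₂ (k , ≡.refl) rewrite ψ-gen-bipartite i | ψ-gen-added k =
    PK.commute-ε (xᴷ i) , ℤ₂^-comm m _ _
  ... | inj₂ (k , ≡.refl) | inj₁ (i , ≡.refl) rewrite ψ-gen-added k | ψ-gen-bipartite i =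
    ΓK.sym (PK.commute-ε (xᴷ i)) , ℤ₂^-comm m _ _
  ... | inj₂ (k , ≡.refl) | inj₂ (k′ , ≡.refl) rewrite ψ-gen-added k | ψ-gen-added k′ =
    ΓK.refl , ℤ₂^-comm m _ _
  ψ-respects (vertex v) = ψ-vertex v

  ψ-cong : ∀ {u v} → u ΓG.≈ v → ψ u T.≈ ψ v
  ψ-cong = PT.eval-cong (ΓRel G) ψ-gen ψ-respects

  φ-gen′ : Fin (3 * n) ⊎ Fin 0 → Word (Fin (3 * n + m))
  φ-gen′ (inj₁ i)  = x i · ŷ (τ i)
  φ-gen′ (inj₂ ())

  φ-gen : Fin (3 * n + 0) → Word (Fin (3 * n + m))
  φ-gen = φ-gen′ ∘ splitAt (3 * n)

  φ-gen-bipartite : ∀ i → φ-gen (i ↑ˡ 0) ≡ x i · ŷ (τ i)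
  φ-gen-bipartite i = ≡.cong φ-gen′ (splitAt-↑ˡ (3 * n) i 0)

  φᴷ : Word (Fin (3 * n + 0)) → Word (Fin (3 * n + m))
  φᴷ = PG.eval φ-gen

  twist-square : ∀ {u} z → u · u ΓG.≈ e → (u · ŷ z) · (u · ŷ z) ΓG.≈ e
  twist-square {u} z u²≈e =
    ΓG.trans (interchange (ΓG.sym (ŷ-central u z))) (ΓG.trans (ΓG.∙-cong u²≈e (ŷ-square z)) (ΓG.identityˡ e))

  twist-commute : ∀ {u v} z z′ → Commute u v → Commute (u · ŷ z) (v · ŷ z′)
  twist-commute {u} {v} z z′ uv = begin
    (u · ŷ z) · (v · ŷ z′)  ≈⟨ interchange (ΓG.sym (ŷ-central v z)) ⟩
    (u · v) · (ŷ z · ŷ z′)  ≈⟨ ΓG.∙-cong uv (ŷ-central (ŷ z) z′) ⟩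
    (v · u) · (ŷ z′ · ŷ z)  ≈⟨ interchange (ΓG.sym (ŷ-central u z′)) ⟨
    (v · ŷ z′) · (u · ŷ z)  ∎
    where open import Relation.Binary.Reasoning.Setoid ΓG.setoid

  ∏-twist : ∀ {A : Set} (a : A → Word (Fin (3 * n + m))) (t : A → Zm.Carrier) xs →
    ∏ (λ i → a i · ŷ (t i)) xs ΓG.≈ ∏ a xs · ŷ (PZ.∏ t xs)
  ∏-twist a t []       = ΓG.sym (ΓG.trans (ΓG.identityˡ _) (lift-ε m y))
  ∏-twist a t (i ∷ xs) = begin
    (a i · ŷ (t i)) · ∏ (λ i → a i · ŷ (t i)) xs  ≈⟨ ΓG.∙-congˡ (∏-twist a t xs) ⟩
    (a i · ŷ (t i)) · (∏ a xs · ŷ (PZ.∏ t xs))    ≈⟨ interchange (ΓG.sym (ŷ-central (∏ a xs) (t i))) ⟩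
    (a i · ∏ a xs) · (ŷ (t i) · ŷ (PZ.∏ t xs))    ≈⟨ ΓG.∙-congˡ (ŷ-∙ (t i) (PZ.∏ t xs)) ⟨
    (a i · ∏ a xs) · ŷ (PZ.∏ t (i ∷ xs))          ∎
    where open import Relation.Binary.Reasoning.Setoid ΓG.setoid

  φᴷ-vertex : ∀ v → φᴷ (vertexProduct K v) ΓG.≈ e
  φᴷ-vertex v = begin
    φᴷ (vertexProduct K v)                                   ≡⟨ PG.eval-foldr φ-gen (edgesAt K v) ⟩
    ∏ φ-gen (edgesAt K v)                                    ≈⟨ IK.∏-edgesAt (Γ G) φ-gen v ⟩
    ∏ (φ-gen ∘ (_↑ˡ 0)) LK · e                               ≈⟨ ΓG.identityʳ _ ⟩
    ∏ (φ-gen ∘ (_↑ˡ 0)) LK                                   ≈⟨ PG.∏-cong (ΓG.reflexive ∘ φ-gen-bipartite) LK ⟩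
    ∏ (λ i → x i · ŷ (τ i)) LK                               ≈⟨ ∏-twist x τ LK ⟩
    ∏ x LK · ŷ (PZ.∏ τ LK)                                   ≈⟨ ΓG.∙-congˡ (lift-cong m y (∏-τ v)) ⟩
    ∏ x LK · ŷ (PZ.∏ (basis m) (addedEdgesAt v))             ≈⟨ ΓG.∙-congˡ (ŷ-∏ (basis m) (addedEdgesAt v)) ⟩
    ∏ x LK · ∏ (ŷ ∘ basis m) (addedEdgesAt v)                ≈⟨ ΓG.∙-congˡ (PG.∏-cong (lift-basis m y) (addedEdgesAt v)) ⟩
    ∏ x LK · ∏ y (addedEdgesAt v)                            ≈⟨ vertex-relation v ⟩
    e                                                        ∎
    where
    open import Relation.Binary.Reasoning.Setoid ΓG.setoid
    LK = bipartiteEdgesAt v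

  φᴷ-respects : ∀ {u v} → ΓRel K u v → φᴷ u ΓG.≈ φᴷ v
  φᴷ-respects (square ed) with Fin+-view (3 * n) 0 ed
  ... | inj₁ (i , ≡.refl) rewrite φ-gen-bipartite i = twist-square (τ i) (rel (square (i ↑ˡ m)))
  ... | inj₂ (() , _)
  φᴷ-respects (commute v ed ed′ ed∋v ed′∋v) with Fin+-view (3 * n) 0 ed | Fin+-view (3 * n) 0 ed′
  ... | inj₁ (i , ≡.refl) | inj₁ (i′ , ≡.refl) rewrite φ-gen-bipartite i | φ-gen-bipartite i′ =
    twist-commute (τ i) (τ i′) (rel (commute v (i ↑ˡ m) (i′ ↑ˡ m)
      (bipartite-incident {i = i} (IK.incident-bipartite {i = i} ed∋v))
      (bipartite-incident {i = i′} (IK.incident-bipartite {i = i′} ed′∋v))))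
  ... | inj₂ (() , _) | _
  ... | _             | inj₂ (() , _)
  φᴷ-respects (vertex v) = φᴷ-vertex v

  φ : T.Carrier → Word (Fin (3 * n + m))
  φ (w , z) = φᴷ w · ŷ z

  φ-cong : ∀ {s t} → s T.≈ t → φ s ΓG.≈ φ t
  φ-cong (w≈w′ , z≈z′) = ΓG.∙-cong (PG.eval-cong (ΓRel K) φ-gen φᴷ-respects w≈w′) (lift-cong m y z≈z′)

  φ-∙ : ∀ s t → φ (s T.∙ t) ΓG.≈ φ s · φ t
  φ-∙ (w , z) (w′ , z′) = begin
    (φᴷ w · φᴷ w′) · ŷ (Zm._∙_ z z′)   ≈⟨ ΓG.∙-congˡ (ŷ-∙ z z′) ⟩
    (φᴷ w · φᴷ w′) · (ŷ z · ŷ z′)      ≈⟨ interchange (ΓG.sym (ŷ-central (φᴷ w′) z)) ⟨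
    (φᴷ w · ŷ z) · (φᴷ w′ · ŷ z′)      ∎
    where open import Relation.Binary.Reasoning.Setoid ΓG.setoid

  φ-ε : φ T.ε ΓG.≈ e
  φ-ε = ΓG.trans (ΓG.identityˡ _) (lift-ε m y)

  φ-⁻¹ : ∀ t → φ (t T.⁻¹) ΓG.≈ inv (φ t)
  φ-⁻¹ t = inverseˡ-unique (φ (t T.⁻¹)) (φ t)
    (ΓG.trans (ΓG.sym (φ-∙ (t T.⁻¹) t)) (ΓG.trans (φ-cong (T.inverseˡ t)) φ-ε))
    where open import Algebra.Properties.Group (Γ G) using (inverseˡ-unique)

  φ∘ψ : ∀ w → φ (ψ w) ΓG.≈ w
  φ∘ψ (gen ed) with Fin+-view (3 * n) m ed
  ... | inj₁ (i , ≡.refl) rewrite ψ-gen-bipartite i | φ-gen-bipartite i =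
    ΓG.trans (ΓG.assoc _ _ _) (ΓG.trans (ΓG.∙-congˡ (ŷ-square (τ i))) (ΓG.identityʳ (x i)))
  ... | inj₂ (k , ≡.refl) rewrite ψ-gen-added k =
    ΓG.trans (ΓG.identityˡ _) (lift-basis m y k)
  φ∘ψ e       = φ-ε
  φ∘ψ (u · v) = ΓG.trans (φ-∙ (ψ u) (ψ v)) (ΓG.∙-cong (φ∘ψ u) (φ∘ψ v))
  φ∘ψ (inv u) = ΓG.trans (φ-⁻¹ (ψ u)) (ΓG.⁻¹-cong (φ∘ψ u))

  ψ-ŷ : ∀ z → ψ (ŷ z) T.≈ (e , z)
  ψ-ŷ z = begin
    ψ (ŷ z)                                  ≈⟨ eval-lift T (ΓRel G) ψ-gen m y z ⟩
    Lift.lift T m (ψ-gen ∘ ((3 * n) ↑ʳ_)) z  ≈⟨ Lift.lift-congᵍ T m (T.reflexive ∘ ψ-gen-added) z ⟩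
    Lift.lift T m (λ k → e , basis m k) z    ≈⟨ lift-pair m (λ k → e , basis m k) z ⟩
    (Lift.lift (Γ K) m (λ _ → e) z , Lift.lift (ℤ₂^ m) m (basis m) z)
                                             ≈⟨ Lift.lift-trivial (Γ K) m (λ _ → ΓK.refl) z , lift-basis-id m z ⟩
    (e , z)                                  ∎
    where open import Relation.Binary.Reasoning.Setoid T.setoid

  ψ∘φᴷ : ∀ w → ψ (φᴷ w) T.≈ (w , Zm.ε)
  ψ∘φᴷ (gen ed) with Fin+-view (3 * n) 0 ed
  ... | inj₁ (i , ≡.refl) rewrite φ-gen-bipartite i | ψ-gen-bipartite i =
    T.trans (T.∙-congˡ (ψ-ŷ (τ i))) (ΓK.identityʳ _ , ℤ₂^-square m (τ i))
  ... | inj₂ (() , _)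
  ψ∘φᴷ e       = T.refl
  ψ∘φᴷ (u · v) = T.trans (T.∙-cong (ψ∘φᴷ u) (ψ∘φᴷ v)) (ΓK.refl , Zm.identityˡ Zm.ε)
  ψ∘φᴷ (inv u) = T.trans (T.⁻¹-cong (ψ∘φᴷ u)) (ΓK.refl , ℤ₂^-inverse m Zm.ε)

  ψ∘φ : ∀ t → ψ (φ t) T.≈ t
  ψ∘φ (w , z) = T.trans (T.∙-cong (ψ∘φᴷ w) (ψ-ŷ z)) (ΓK.identityʳ w , Zm.identityˡ z)

  ψ-isomorphism : GroupMorphisms.IsGroupIsomorphism (Group.rawGroup (Γ G)) (Group.rawGroup T) ψ
  ψ-isomorphism = record
    { isGroupMonomorphism = record
      { isGroupHomomorphism = record
        { isMonoidHomomorphism = record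
          { isMagmaHomomorphism = record
            { isRelHomomorphism = record { cong = ψ-cong }
            ; homo = λ _ _ → T.refl }
          ; ε-homo = T.refl }
        ; ⁻¹-homo = λ _ → T.refl }
      ; injective = λ {u} {v} ψu≈ψv → ΓG.trans (ΓG.sym (φ∘ψ u)) (ΓG.trans (φ-cong ψu≈ψv) (φ∘ψ v)) }
    ; surjective = λ t → φ t , λ {w} w≈φt → T.trans (ψ-cong w≈φt) (ψ∘φ t) }

proposition5p13 : (n m : ℕ) → 1 ≤ n →
    (f : Fin m → Fin 3 × Fin 3) → (∀ k → proj₁ (f k) ≢ proj₂ (f k)) →
    Γ (K3n+ n m f) ≅ᴳ (Γ (K3n n) ×ᴳ ℤ₂^ m)
proposition5p13 zero     m ()  f f-loopless
proposition5p13 (suc n′) m _   f f-loopless = ψ , ψ-isomorphism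
  where open Isomorphism n′ m f f-loopless
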